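{- Let $k,r,q,a,b,b'$ be integers with $r,q>0$, $a\ge k$, and $b\ge r\cdot b'+a$. Let $\Pi=(X,\Sigma,\Phi)$ be a 2CSP instance and consider its $(a,b)$-bipartite direct product. Let $u$ be an $r$-sized multi-assignment for $\binom{X}{a}$ and $v$ a $q$-sized multi-assignment for $\binom{X}{b}$. Suppose that for every $S\in\binom{X}{a}$ and $T\in\binom{X}{b}$ with $T\supseteq S$ we have $v(T)_{|S}\cap u(S)\neq\emptyset$. Then for every $A\in\binom{X}{k}$ there is an assignment $f_A$ for $A$ such that for every $T'\in\binom{X}{b'}$ there is some $T\in\binom{X}{b}$ with $T\supseteq T'\cup A$ and $f_A\in v(T)_{|A}$.
   Context: A 2CSP instance $\Pi=(X,\Sigma,\Phi)$ consists of a finite set of variables $X$, a domain $\Sigma_x$ for each $x\in X$, and constraints, each a pair of distinct variables with a binary relation on their domains. For $m\ge1$, $\binom{X}{m}$ denotes the set of $m$-element subsets of $X$. A partial satisfying assignment for $S\subseteq X$ is a function giving each $x\in S$ a value in $\Sigma_x$ such that every constraint of $\Pi$ whose two variables both lie in $S$ is satisfied. The $(a,b)$-bipartite direct product of $\Pi$ has variables $\binom{X}{a}$ (left side) and $\binom{X}{b}$ (right side), the domain of each variable $S$ being the set of partial satisfying assignments for $S$, and for every $S\in\binom{X}{a}$, $T\in\binom{X}{b}$ a constraint requiring the assignments of $S$ and $T$ to agree on $S\cap T$. A $p$-sized multi-assignment for $\binom{X}{m}$ maps each $S\in\binom{X}{m}$ to a set $u(S)$ of at most $p$ partial satisfying assignments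 for $S$. For a set $F$ of assignments to a set $T$ and $S\subseteq T$, $F_{|S}$ denotes the set of restrictions to $S$ of the elements of $F$. -}

module Defs where

open import Data.Nat using (ℕ)
open import Data.Fin using (Fin)
open import Data.Fin.Subset using (Subset; _∈_)
open import Data.List using (List)
open import Data.List.Relation.Unary.All using (All)
open import Data.List.Relation.Unary.Any using (Any)
open import Relation.Binary.PropositionalEquality using (_≡_; _≢_)

record Constraint {n : ℕ} (Dom : Fin n → Set) : Set₁ where
  field
    x y      : Fin n
    distinct : x ≢ y
    rel      : Dom x → Dom y → Set

record CSP (n : ℕ) : Set₁ where
  field
    Dom  : Fin n → Set
    cons : List (Constraint Dom)

module _ {n : ℕ} (Π : CSP n) where
  open CSP Π
  open Constraint

  Assignment : Subset n → Set
  Assignment S = (z : Fin n) → z ∈ S → Dom z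

  Satisfying : (S : Subset n) → Assignment S → Set₁
  Satisfying S f =
    All (λ c → (p : x c ∈ S) (q : y c ∈ S) → rel c (f (x c) p) (f (y c) q)) cons

  RestrictsTo : (A T : Subset n) → Assignment T → Assignment A → Set
  RestrictsTo A T g f = (z : Fin n) (p : z ∈ A) (q : z ∈ T) → g z q ≡ f z p

  _∈Restr_ : {A T : Subset n} → Assignment A → List (Assignment T) → Set
  _∈Restr_ {A} {T} f F = Any (λ g → RestrictsTo A T g f) F

{-# OPTIONS --safe #-}
-- Extend A to some S ∈ (X choose a) and, for every T ⊇ S of size b, let colour(T) be the
-- index in u(S) of an assignment lying in v(T)_{|S}.  Some colour i is popular: every b'-set
-- lies inside a b-set T ⊇ S of colour i.  Otherwise each of the at most r colours is missed by
-- some b'-set, and a b-set containing S together with all these (at most a + r b' ≤ b)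
-- elements would have no colour.  The restriction to A of the i-th element of u(S) is f_A.
module Submission where

open import Defs
open import Data.Nat using (ℕ; zero; suc; _≤_; _+_; _*_; _>_; z≤n; s≤s) renaming (_≟_ to _≟ℕ_)
open import Data.Nat.Properties
  using (≤-trans; ≤-reflexive; +-mono-≤; +-monoʳ-≤; +-suc; +-comm; *-monoˡ-≤; m≤n+m; ≤∧≢⇒<; m<1+n⇒m≤n; module ≤-Reasoning)
open import Data.Fin using (Fin)
open import Data.Fin.Properties using (any?) renaming (_≟_ to _≟Fin_)
open import Data.Fin.Subset using (Subset; ∣_∣; _⊆_; _∪_; ⋃; ⊥; ⊤; inside; outside)
open import Data.Fin.Subset.Properties
  using (∣p∣≤∣x∷p∣; ∣⊥∣≡0; ∣⊤∣≡n; ⊆⊤; ⊆-refl; ⊆-trans; _⊆?_; anySubset?; p⊆p∪q; q⊆p∪q; x∈p∪q⁻; s⊆s; out⊆)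
open import Data.Vec using ([]; _∷_)
open import Data.List using (List; []; _∷_; length; lookup; tabulate)
open import Data.List.Properties using (length-tabulate)
open import Data.List.Membership.Propositional using (_∈_)
open import Data.List.Membership.Propositional.Properties using (∈-tabulate⁺)
open import Data.List.Relation.Unary.All using (All; []; _∷_)
import Data.List.Relation.Unary.All.Properties as All
open import Data.List.Relation.Unary.Any using (Any; here; there)
import Data.List.Relation.Unary.Any as Any
open import Data.List.Relation.Unary.Any.Properties using (lookup-index)
open import Data.Maybe using (Maybe; just; nothing)
open import Data.Maybe.Properties using () renaming (≡-dec to ≡-decMaybe)
open import Data.Product using (Σ; _×_; _,_; proj₁; proj₂; ∃)
open import Data.Sum using (inj₁; inj₂)
open import Data.Empty using (⊥-elim)
open import Relation.Nullary using (¬_; Dec; yes; no; ¬?)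
open import Relation.Nullary.Decidable using (_×-dec_; decidable-stable)
open import Relation.Binary.PropositionalEquality using (_≡_; refl; cong)

private
  variable
    n : ℕ

∪-least : {p q r : Subset n} → p ⊆ r → q ⊆ r → p ∪ q ⊆ r
∪-least {p = p} {q} p⊆r q⊆r x∈p∪q with x∈p∪q⁻ p q x∈p∪q
... | inj₁ x∈p = p⊆r x∈p
... | inj₂ x∈q = q⊆r x∈q

∣p∪q∣≤∣p∣+∣q∣ : (p q : Subset n) → ∣ p ∪ q ∣ ≤ ∣ p ∣ + ∣ q ∣
∣p∪q∣≤∣p∣+∣q∣ []            []            = z≤n
∣p∪q∣≤∣p∣+∣q∣ (inside ∷ p)  (s ∷ q)       =
  s≤s (≤-trans (∣p∪q∣≤∣p∣+∣q∣ p q) (+-monoʳ-≤ ∣ p ∣ (∣p∣≤∣x∷p∣ s q)))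
∣p∪q∣≤∣p∣+∣q∣ (outside ∷ p) (inside ∷ q)  rewrite +-suc ∣ p ∣ ∣ q ∣ = s≤s (∣p∪q∣≤∣p∣+∣q∣ p q)
∣p∪q∣≤∣p∣+∣q∣ (outside ∷ p) (outside ∷ q) = ∣p∪q∣≤∣p∣+∣q∣ p q

∣⋃∣≤length* : ∀ {c} (ps : List (Subset n)) → All (λ p → ∣ p ∣ ≤ c) ps → ∣ ⋃ ps ∣ ≤ length ps * c
∣⋃∣≤length* {n} []       []           = ≤-reflexive (∣⊥∣≡0 n)
∣⋃∣≤length* (p ∷ ps) (∣p∣≤c ∷ ∣ps∣≤c) =
  ≤-trans (∣p∪q∣≤∣p∣+∣q∣ p (⋃ ps)) (+-mono-≤ ∣p∣≤c (∣⋃∣≤length* ps ∣ps∣≤c))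

⊆⋃ : {p : Subset n} {ps : List (Subset n)} → p ∈ ps → p ⊆ ⋃ ps
⊆⋃ {ps = q ∷ ps} (here refl) = p⊆p∪q (⋃ ps)
⊆⋃ {ps = q ∷ ps} (there p∈ps) = ⊆-trans (⊆⋃ p∈ps) (q⊆p∪q q (⋃ ps))

⊆-extend-to-size : ∀ m (U : Subset n) → ∣ U ∣ ≤ m → m ≤ n → ∃ λ T → U ⊆ T × ∣ T ∣ ≡ m
⊆-extend-to-size {zero}  zero []  _ _ = [] , ⊆-refl , refl
⊆-extend-to-size {suc n} m    U   ∣U∣≤m m≤1+n with m ≟ℕ suc n
... | yes refl = ⊤ , ⊆⊤ , ∣⊤∣≡n (suc n)
⊆-extend-to-size {suc n} m (outside ∷ U) ∣U∣≤m m≤1+n | no m≢1+n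
  with ⊆-extend-to-size m U ∣U∣≤m (m<1+n⇒m≤n (≤∧≢⇒< m≤1+n m≢1+n))
... | T , U⊆T , ∣T∣≡m = outside ∷ T , out⊆ U⊆T , ∣T∣≡m
⊆-extend-to-size {suc n} (suc m) (inside ∷ U) (s≤s ∣U∣≤m) (s≤s m≤n) | no _
  with ⊆-extend-to-size m U ∣U∣≤m m≤n
... | T , U⊆T , ∣T∣≡m = inside ∷ T , s⊆s U⊆T , cong suc ∣T∣≡m

-- A partial colouring of subsets; `nothing` marks uncoloured sets.  Maybe-valued rather than
-- proof-dependent so that "T' lies below a set of colour i" stays decidable.
module _ {L : ℕ} (colour : Subset n → Maybe (Fin L)) where

  BelowColour : Fin L → Subset n → Set
  BelowColour i T' = ∃ λ T → T' ⊆ T × colour T ≡ just i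

  belowColour? : ∀ i T' → Dec (BelowColour i T')
  belowColour? i T' = anySubset? λ T → (T' ⊆? T) ×-dec ≡-decMaybe _≟Fin_ (colour T) (just i)

  Missed : ℕ → Fin L → Set
  Missed b' i = ∃ λ T' → ∣ T' ∣ ≡ b' × ¬ BelowColour i T'

  missed? : ∀ b' i → Dec (Missed b' i)
  missed? b' i = anySubset? λ T' → (∣ T' ∣ ≟ℕ b') ×-dec ¬? (belowColour? i T')

  module _ (S : Subset n) {b b'} (coloured : ∀ T → ∣ T ∣ ≡ b → S ⊆ T → ∃ λ i → colour T ≡ just i)
           (bound : ∣ S ∣ + L * b' ≤ b) (b≤n : b ≤ n) where

    ¬everyColourMissed : ¬ (∀ i → Missed b' i)
    ¬everyColourMissed missed with ⊆-extend-to-size b (S ∪ ⋃ witnesses) ∣S∪witnesses∣≤b b≤n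
      where
      witness : Fin L → Subset n
      witness i = proj₁ (missed i)

      witnesses : List (Subset n)
      witnesses = tabulate witness

      ∣S∪witnesses∣≤b : ∣ S ∪ ⋃ witnesses ∣ ≤ b
      ∣S∪witnesses∣≤b = begin
        ∣ S ∪ ⋃ witnesses ∣           ≤⟨ ∣p∪q∣≤∣p∣+∣q∣ S (⋃ witnesses) ⟩
        ∣ S ∣ + ∣ ⋃ witnesses ∣       ≤⟨ +-monoʳ-≤ ∣ S ∣ (∣⋃∣≤length* witnesses witnesses-small) ⟩
        ∣ S ∣ + length witnesses * b' ≡⟨ cong (λ l → ∣ S ∣ + l * b') (length-tabulate witness) ⟩
        ∣ S ∣ + L * b'                ≤⟨ bound ⟩
        b                             ∎
        where
        open ≤-Reasoning
        witnesses-small : All (λ T' → ∣ T' ∣ ≤ b') witnesses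
        witnesses-small = All.tabulate⁺ λ i → ≤-reflexive (proj₁ (proj₂ (missed i)))
    ... | T , S∪witnesses⊆T , ∣T∣≡b with coloured T ∣T∣≡b (⊆-trans (p⊆p∪q _) S∪witnesses⊆T)
    ... | j , colourT≡j = proj₂ (proj₂ (missed j))
      (T , ⊆-trans (⊆⋃ (∈-tabulate⁺ j)) (⊆-trans (q⊆p∪q S _) S∪witnesses⊆T) , colourT≡j)

    popularColour : ∃ λ i → ∀ T' → ∣ T' ∣ ≡ b' → BelowColour i T'
    popularColour with any? (λ i → ¬? (missed? b' i))
    ... | yes (i , ¬missed) =
      i , λ T' ∣T'∣≡b' → decidable-stable (belowColour? i T') λ ¬below → ¬missed (T' , ∣T'∣≡b' , ¬below)
    ... | no ¬someNotMissed = ⊥-elim (¬everyColourMissed λ i →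
      decidable-stable (missed? b' i) λ ¬missed → ¬someNotMissed (i , ¬missed))

module _ (Π : CSP n) where

  restrict : {A S : Subset n} → A ⊆ S → Assignment Π S → Assignment Π A
  restrict A⊆S f z z∈A = f z (A⊆S z∈A)

  ∈Restr-restrict : {A S T : Subset n} (A⊆S : A ⊆ S) {f : Assignment Π S} {F : List (Assignment Π T)} →
    _∈Restr_ Π f F → _∈Restr_ Π (restrict A⊆S f) F
  ∈Restr-restrict A⊆S = Any.map λ g↾S≡f z z∈A z∈T → g↾S≡f z (A⊆S z∈A) z∈T

  module _ {a b : ℕ} (u v : (S : Subset n) → List (Assignment Π S))
    (agree : (S T : Subset n) → ∣ S ∣ ≡ a → ∣ T ∣ ≡ b → S ⊆ T → Any (λ f → _∈Restr_ Π f (v T)) (u S))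
    (S : Subset n) (∣S∣≡a : ∣ S ∣ ≡ a) where

    agreeingIndex : Subset n → Maybe (Fin (length (u S)))
    agreeingIndex T with ∣ T ∣ ≟ℕ b | S ⊆? T
    ... | yes ∣T∣≡b | yes S⊆T = just (Any.index (agree S T ∣S∣≡a ∣T∣≡b S⊆T))
    ... | _         | _       = nothing

    agreeingIndex-complete : ∀ T → ∣ T ∣ ≡ b → S ⊆ T → ∃ λ i → agreeingIndex T ≡ just i
    agreeingIndex-complete T ∣T∣≡b S⊆T with ∣ T ∣ ≟ℕ b | S ⊆? T
    ... | yes _     | yes _    = _ , refl
    ... | no ∣T∣≢b  | _        = ⊥-elim (∣T∣≢b ∣T∣≡b)
    ... | yes _     | no S⊈T   = ⊥-elim (S⊈T S⊆T)

    agreeingIndex-sound : ∀ T {i} → agreeingIndex T ≡ just i →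
      ∣ T ∣ ≡ b × S ⊆ T × _∈Restr_ Π (lookup (u S) i) (v T)
    agreeingIndex-sound T eq with ∣ T ∣ ≟ℕ b | S ⊆? T
    agreeingIndex-sound T refl | yes ∣T∣≡b | yes S⊆T =
      ∣T∣≡b , S⊆T , lookup-index (agree S T ∣S∣≡a ∣T∣≡b S⊆T)
    agreeingIndex-sound T ()   | yes _ | no _
    agreeingIndex-sound T ()   | no _  | _

lemma3p4 : (k r q a b b' : ℕ) → r > 0 → q > 0 → k ≤ a → r * b' + a ≤ b →
    (n : ℕ) → b ≤ n → (Π : CSP n) →
    (u : (S : Subset n) → List (Assignment Π S)) →
    ((S : Subset n) → ∣ S ∣ ≡ a → length (u S) ≤ r × All (Satisfying Π S) (u S)) →
    (v : (T : Subset n) → List (Assignment Π T)) →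
    ((T : Subset n) → ∣ T ∣ ≡ b → length (v T) ≤ q × All (Satisfying Π T) (v T)) →
    ((S T : Subset n) → ∣ S ∣ ≡ a → ∣ T ∣ ≡ b → S ⊆ T →
      Any (λ f → _∈Restr_ Π f (v T)) (u S)) →
    (A : Subset n) → ∣ A ∣ ≡ k →
    Σ (Assignment Π A) λ fA →
      (T' : Subset n) → ∣ T' ∣ ≡ b' →
      Σ (Subset n) λ T → ∣ T ∣ ≡ b × (T' ∪ A) ⊆ T × _∈Restr_ Π fA (v T)
lemma3p4 k r q a b b' _ _ k≤a r*b'+a≤b n b≤n Π u u-small v _ agree A ∣A∣≡k
  with ⊆-extend-to-size a A (≤-trans (≤-reflexive ∣A∣≡k) k≤a) (≤-trans (≤-trans (m≤n+m a (r * b')) r*b'+a≤b) b≤n)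
... | S , A⊆S , ∣S∣≡a
  with popularColour (agreeingIndex Π u v agree S ∣S∣≡a) S (agreeingIndex-complete Π u v agree S ∣S∣≡a)
         ∣S∣+∣uS∣*b'≤b b≤n
  where
  ∣S∣+∣uS∣*b'≤b : ∣ S ∣ + length (u S) * b' ≤ b
  ∣S∣+∣uS∣*b'≤b = begin
    ∣ S ∣ + length (u S) * b' ≡⟨ cong (_+ length (u S) * b') ∣S∣≡a ⟩
    a + length (u S) * b'     ≤⟨ +-monoʳ-≤ a (*-monoˡ-≤ b' (proj₁ (u-small S ∣S∣≡a))) ⟩
    a + r * b'                ≡⟨ +-comm a (r * b') ⟩
    r * b' + a                ≤⟨ r*b'+a≤b ⟩
    b                         ∎
    where open ≤-Reasoning
... | i , popular = restrict Π A⊆S (lookup (u S) i) , covered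
  where
  covered : ∀ T' → ∣ T' ∣ ≡ b' →
    ∃ λ T → ∣ T ∣ ≡ b × (T' ∪ A) ⊆ T × _∈Restr_ Π (restrict Π A⊆S (lookup (u S) i)) (v T)
  covered T' ∣T'∣≡b' with popular T' ∣T'∣≡b'
  ... | T , T'⊆T , colourT≡i with agreeingIndex-sound Π u v agree S ∣S∣≡a T colourT≡i
  ... | ∣T∣≡b , S⊆T , agrees = T , ∣T∣≡b , ∪-least T'⊆T (⊆-trans A⊆S S⊆T) , ∈Restr-restrict Π A⊆S agrees
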